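{- For all closed terms $P,Q\in\mathcal{SP}^{\mathsf U}_A$: $\mathrm{EqFFEL}^{\mathsf U}\vdash P=Q$ if and only if $\mathit{fe}^{\mathsf U}(P)=\mathit{fe}^{\mathsf U}(Q)$. (That is, the logic $\mathrm{FFEL}^{\mathsf U}$, defined by $\mathrm{FFEL}^{\mathsf U}\models P=Q \iff \mathit{fe}^{\mathsf U}(P)=\mathit{fe}^{\mathsf U}(Q)$, is axiomatised by $\mathrm{EqFFEL}^{\mathsf U}$.)
   Context: Let $A$ be a countable set of atoms. $\mathcal{SP}^{\mathsf U}_A$ is the set of closed terms generated by $P::=\mathsf T\mid\mathsf F\mid\mathsf U\mid a\mid \neg P\mid P\mathbin{\wedge_\bullet}P\mid P\mathbin{\vee_\bullet}P$ ($a\in A$), where $\mathbin{\wedge_\bullet},\mathbin{\vee_\bullet}$ are binary function symbols (left-sequential full conjunction/disjunction) and $\mathsf T,\mathsf F,\mathsf U$ are constants. $\mathcal T^{\mathsf U}_A$ (U-evaluation trees) is defined inductively: $\mathsf T,\mathsf F,\mathsf U\in\mathcal T^{\mathsf U}_A$, and $(X\trianglelefteq a\trianglerighteq Y)\in\mathcal T^{\mathsf U}_A$ for $X,Y\in\mathcal T^{\mathsf U}_A$, $a\in A$ (root $a$, left subtree $X$, right subtree $Y$). Leaf replacement: $\mathsf T[\mathsf T\mapsto Y,\mathsf F\mapsto Z]=Y$, $\mathsf F[\mathsf T\mapsto Y,\mathsf F\mapsto Z]=Z$, $\mathsf U[\mathsf T\mapsto Y,\mathsf F\mapsto Z]=\mathsf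 U$, $(X_1\trianglelefteq a\trianglerighteq X_2)[\mathsf T\mapsto Y,\mathsf F\mapsto Z]=X_1[\dots]\trianglelefteq a\trianglerighteq X_2[\dots]$; an omitted replacement is the identity (e.g. $X[\mathsf T\mapsto\mathsf F]=X[\mathsf T\mapsto \mathsf F,\mathsf F\mapsto\mathsf F]$). $\mathit{fe}^{\mathsf U}:\mathcal{SP}^{\mathsf U}_A\to\mathcal T^{\mathsf U}_A$: $\mathit{fe}^{\mathsf U}(B)=B$ for $B\in\{\mathsf T,\mathsf F,\mathsf U\}$, $\mathit{fe}^{\mathsf U}(a)=\mathsf T\trianglelefteq a\trianglerighteq\mathsf F$, $\mathit{fe}^{\mathsf U}(\neg P)=\mathit{fe}^{\mathsf U}(P)[\mathsf T\mapsto\mathsf F,\mathsf F\mapsto\mathsf T]$, $\mathit{fe}^{\mathsf U}(P\mathbin{\wedge_\bullet}Q)=\mathit{fe}^{\mathsf U}(P)[\mathsf T\mapsto\mathit{fe}^{\mathsf U}(Q),\mathsf F\mapsto\mathit{fe}^{\mathsf U}(Q)[\mathsf T\mapsto\mathsf F]]$, $\mathit{fe}^{\mathsf U}(P\mathbin{\vee_\bullet}Q)=\mathit{fe}^{\mathsf U}(P)[\mathsf T\mapsto\mathit{fe}^{\mathsf U}(Q)[\mathsf F\mapsto\mathsf T],\mathsf F\mapsto\mathit{fe}^{\mathsf U}(Q)]$. $\mathrm{EqFFEL}$ consists of the equations (variables $x,y,z$): $\mathsf F=\neg\mathsf T$; $x\mathbin{\vee_\bullet}y=\neg(\neg x\mathbin{\wedge_\bullet}\neg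 y)$; $\neg\neg x=x$; $(x\mathbin{\wedge_\bullet}y)\mathbin{\wedge_\bullet}z=x\mathbin{\wedge_\bullet}(y\mathbin{\wedge_\bullet}z)$; $\mathsf T\mathbin{\wedge_\bullet}x=x$; $x\mathbin{\wedge_\bullet}\mathsf T=x$; $x\mathbin{\wedge_\bullet}\mathsf F=\mathsf F\mathbin{\wedge_\bullet}x$; $\neg x\mathbin{\wedge_\bullet}\mathsf F=x\mathbin{\wedge_\bullet}\mathsf F$; $(x\mathbin{\wedge_\bullet}\mathsf F)\mathbin{\vee_\bullet}y=(x\mathbin{\vee_\bullet}\mathsf T)\mathbin{\wedge_\bullet}y$; $x\mathbin{\vee_\bullet}(y\mathbin{\wedge_\bullet}\mathsf F)=x\mathbin{\wedge_\bullet}(y\mathbin{\vee_\bullet}\mathsf T)$. $\mathrm{EqFFEL}^{\mathsf U}=\mathrm{EqFFEL}\cup\{\neg\mathsf U=\mathsf U,\ \mathsf U\mathbin{\wedge_\bullet}x=\mathsf U\}$. $\vdash$ denotes derivability in equational logic. -}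

module Defs where

open import Data.Nat using (ℕ)
open import Function.Bundles using (_↣_)

data Term (A : Set) (V : Set) : Set where
  `T `F `U : Term A V
  atom     : A → Term A V
  var      : V → Term A V
  ¬'_      : Term A V → Term A V
  _∧•_     : Term A V → Term A V → Term A V
  _∨•_     : Term A V → Term A V → Term A V

infixr 6 _∧•_
infixr 5 _∨•_
infix  7 ¬'_

data SP (A : Set) : Set where
  `T `F `U : SP A
  atom     : A → SP A
  ¬'_      : SP A → SP A
  _∧•_     : SP A → SP A → SP A
  _∨•_     : SP A → SP A → SP A

subst : {A V : Set} → (V → SP A) → Term A V → SP A
subst σ `T = `T
subst σ `F = `F
subst σ `U = `U
subst σ (atom a) = atom a
subst σ (var x) = σ x
subst σ (¬' t) = ¬' subst σ t
subst σ (t ∧• u) = subst σ t ∧• subst σ u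
subst σ (t ∨• u) = subst σ t ∨• subst σ u

data Var3 : Set where
  x y z : Var3

data Axiom (A : Set) : Term A Var3 → Term A Var3 → Set where
  ax1  : Axiom A `F (¬' `T)
  ax2  : Axiom A (var x ∨• var y) (¬' (¬' var x ∧• ¬' var y))
  ax3  : Axiom A (¬' ¬' var x) (var x)
  ax4  : Axiom A ((var x ∧• var y) ∧• var z) (var x ∧• (var y ∧• var z))
  ax5  : Axiom A (`T ∧• var x) (var x)
  ax6  : Axiom A (var x ∧• `T) (var x)
  ax7  : Axiom A (var x ∧• `F) (`F ∧• var x)
  ax8  : Axiom A (¬' var x ∧• `F) (var x ∧• `F)
  ax9  : Axiom A ((var x ∧• `F) ∨• var y) ((var x ∨• `T) ∧• var y)
  ax10 : Axiom A (var x ∨• (var y ∧• `F)) (var x ∧• (var y ∨• `T))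
  axU1 : Axiom A (¬' `U) `U
  axU2 : Axiom A (`U ∧• var x) `U

-- Derivability in equational logic. Since the claim concerns closed
-- terms, it suffices (and is standard) to derive closed equations:
-- closed instances of axioms, equivalence, and congruence.
infix 4 EqFFELU⊢_≈_
data EqFFELU⊢_≈_ {A : Set} : SP A → SP A → Set where
  axiom : ∀ {l r} → Axiom A l r → (σ : Var3 → SP A) →
          EqFFELU⊢ subst σ l ≈ subst σ r
  refl  : ∀ {P} → EqFFELU⊢ P ≈ P
  sym   : ∀ {P Q} → EqFFELU⊢ P ≈ Q → EqFFELU⊢ Q ≈ P
  trans : ∀ {P Q R} → EqFFELU⊢ P ≈ Q → EqFFELU⊢ Q ≈ R → EqFFELU⊢ P ≈ R
  cong¬ : ∀ {P Q} → EqFFELU⊢ P ≈ Q → EqFFELU⊢ ¬' P ≈ ¬' Q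
  cong∧ : ∀ {P P' Q Q'} → EqFFELU⊢ P ≈ P' → EqFFELU⊢ Q ≈ Q' →
          EqFFELU⊢ P ∧• Q ≈ P' ∧• Q'
  cong∨ : ∀ {P P' Q Q'} → EqFFELU⊢ P ≈ P' → EqFFELU⊢ Q ≈ Q' →
          EqFFELU⊢ P ∨• Q ≈ P' ∨• Q'

data Tree (A : Set) : Set where
  T F U : Tree A
  _⊴_⊵_ : Tree A → A → Tree A → Tree A

_[T↦_,F↦_] : {A : Set} → Tree A → Tree A → Tree A → Tree A
T [T↦ Y ,F↦ Z ] = Y
F [T↦ Y ,F↦ Z ] = Z
U [T↦ Y ,F↦ Z ] = U
(X₁ ⊴ a ⊵ X₂) [T↦ Y ,F↦ Z ] = (X₁ [T↦ Y ,F↦ Z ]) ⊴ a ⊵ (X₂ [T↦ Y ,F↦ Z ])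

fe : {A : Set} → SP A → Tree A
fe `T = T
fe `F = F
fe `U = U
fe (atom a) = T ⊴ a ⊵ F
fe (¬' P) = fe P [T↦ F ,F↦ T ]
fe (P ∧• Q) = fe P [T↦ fe Q ,F↦ (fe Q [T↦ F ,F↦ F ]) ]
fe (P ∨• Q) = fe P [T↦ (fe Q [T↦ T ,F↦ T ]) ,F↦ fe Q ]

Countable : Set → Set
Countable A = A ↣ ℕ

module Submission where

-- Soundness is a computation with leaf replacement.  For completeness, every term is provably
-- equal to a normal form nf P: a left-nested ∧/∨ combination of literals, interleaved with
-- dummy evaluations a ∨ T, in which associativity has been used up.  The tree of a normal form
-- determines it, by induction on the tree.  At a dummy root both subtrees are the tree of the rest.
-- At the first essential literal the subtrees are the trees of the two branches, the normal forms
-- of what remains when the literal is T or F; these are determined by induction.  The branches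
-- differ in their number of essential atoms (the operator after the literal passes one value
-- and absorbs the other), which determines the spine, and the tree is monotone in the value of
-- the literal, which determines its polarity.  Hence fe P = fe Q forces nf P = nf Q.

open import Defs
open import Data.Bool using (Bool; true; false; not)
open import Data.Empty using (⊥; ⊥-elim)
open import Data.List using (List; []; _∷_; _++_)
open import Data.List.Properties using (∷-injective)
open import Data.List.Relation.Unary.All using (All; []; _∷_)
open import Data.Maybe using (Maybe; just; nothing)
open import Data.Nat using (ℕ; suc; _+_; _≤_; _<_; z≤n; s≤s)
open import Data.Nat.Properties
  using (≤-trans; ≤-reflexive; <-irrefl; <-≤-trans; m≤n+m; +-assoc; module ≤-Reasoning)
open import Data.Product using (_×_; _,_; proj₁; ∃₂)
open import Data.Sum using (_⊎_; inj₁; inj₂)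
open import Data.Unit using (⊤; tt)
open import Function.Base using (_∘_)
open import Function.Bundles using (_⇔_; mk⇔)
open import Relation.Binary.PropositionalEquality as ≡
  using (_≡_; _≢_; refl; cong; cong₂)
open import Relation.Nullary using (¬_)

++-≡-++ : {X : Set} (xs ys xs' ys' : List X) → xs ++ ys ≡ xs' ++ ys' →
  (xs ≡ xs' × ys ≡ ys')
  ⊎ (∃₂ λ u us → xs ≡ xs' ++ u ∷ us × ys' ≡ (u ∷ us) ++ ys)
  ⊎ (∃₂ λ u us → xs' ≡ xs ++ u ∷ us × ys ≡ (u ∷ us) ++ ys')
++-≡-++ [] ys [] ys' eq = inj₁ (refl , eq)
++-≡-++ [] ys (w' ∷ ws') ys' eq = inj₂ (inj₂ (w' , ws' , refl , eq))
++-≡-++ (w ∷ ws) ys [] ys' eq = inj₂ (inj₁ (w , ws , refl , ≡.sym eq))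
++-≡-++ (w ∷ ws) ys (w' ∷ ws') ys' eq with ∷-injective eq
... | refl , eq' with ++-≡-++ ws ys ws' ys' eq'
...   | inj₁ (p , q) = inj₁ (cong (w ∷_) p , q)
...   | inj₂ (inj₁ (u , us , p , q)) = inj₂ (inj₁ (u , us , cong (w ∷_) p , q))
...   | inj₂ (inj₂ (u , us , p , q)) = inj₂ (inj₂ (u , us , cong (w ∷_) p , q))

data Op : Set where
  AND OR : Op

dual : Op → Op
dual AND = OR
dual OR = AND

module _ {A : Set} where

  -- Soundness

  replace-assoc : (X B C D E : Tree A) →
    X [T↦ B ,F↦ C ] [T↦ D ,F↦ E ] ≡ X [T↦ B [T↦ D ,F↦ E ] ,F↦ C [T↦ D ,F↦ E ] ]
  replace-assoc T B C D E = refl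
  replace-assoc F B C D E = refl
  replace-assoc U B C D E = refl
  replace-assoc (X₁ ⊴ a ⊵ X₂) B C D E =
    cong₂ (_⊴ a ⊵_) (replace-assoc X₁ B C D E) (replace-assoc X₂ B C D E)

  replace-identity : (X : Tree A) → X [T↦ T ,F↦ F ] ≡ X
  replace-identity T = refl
  replace-identity F = refl
  replace-identity U = refl
  replace-identity (X₁ ⊴ a ⊵ X₂) = cong₂ (_⊴ a ⊵_) (replace-identity X₁) (replace-identity X₂)

  ¬-involutiveᵗ : (X : Tree A) → X [T↦ F ,F↦ T ] [T↦ F ,F↦ T ] ≡ X
  ¬-involutiveᵗ X = ≡.trans (replace-assoc X F T F T) (replace-identity X)

  axiom-sound : ∀ {l r} → Axiom A l r → (σ : Var3 → SP A) → fe (subst σ l) ≡ fe (subst σ r)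
  axiom-sound ax1 σ = refl
  axiom-sound ax2 σ = ≡.sym (begin
      X [T↦ F ,F↦ T ] [T↦ Y¬ ,F↦ Y¬ [T↦ F ,F↦ F ] ] [T↦ F ,F↦ T ]
        ≡⟨ replace-assoc (X [T↦ F ,F↦ T ]) _ _ F T ⟩
      X [T↦ F ,F↦ T ] [T↦ Y¬ [T↦ F ,F↦ T ] ,F↦ Y¬ [T↦ F ,F↦ F ] [T↦ F ,F↦ T ] ]
        ≡⟨ replace-assoc X F T _ _ ⟩
      X [T↦ Y¬ [T↦ F ,F↦ F ] [T↦ F ,F↦ T ] ,F↦ Y¬ [T↦ F ,F↦ T ] ]
        ≡⟨ cong₂ (λ p q → X [T↦ p ,F↦ q ])
             (≡.trans (replace-assoc Y¬ F F F T) (replace-assoc Y F T T T))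
             (¬-involutiveᵗ Y) ⟩
      X [T↦ Y [T↦ T ,F↦ T ] ,F↦ Y ] ∎)
    where
    open ≡.≡-Reasoning
    X = fe (σ x)
    Y = fe (σ y)
    Y¬ = Y [T↦ F ,F↦ T ]
  axiom-sound ax3 σ = ¬-involutiveᵗ (fe (σ x))
  axiom-sound ax4 σ = begin
      X [T↦ Y ,F↦ Y [T↦ F ,F↦ F ] ] [T↦ Z ,F↦ Z [T↦ F ,F↦ F ] ]
        ≡⟨ replace-assoc X _ _ _ _ ⟩
      X [T↦ Y [T↦ Z ,F↦ Z [T↦ F ,F↦ F ] ] ,F↦ Y [T↦ F ,F↦ F ] [T↦ Z ,F↦ Z [T↦ F ,F↦ F ] ] ]
        ≡⟨ cong (λ q → X [T↦ Y [T↦ Z ,F↦ Zꜰ ] ,F↦ q ]) (≡.trans (replace-assoc Y F F Z Zꜰ)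
             (≡.sym (≡.trans (replace-assoc Y Z Zꜰ F F)
               (cong (λ q → Y [T↦ Zꜰ ,F↦ q ]) (replace-assoc Z F F F F))))) ⟩
      X [T↦ Y [T↦ Z ,F↦ Z [T↦ F ,F↦ F ] ] ,F↦ Y [T↦ Z ,F↦ Z [T↦ F ,F↦ F ] ] [T↦ F ,F↦ F ] ] ∎
    where
    open ≡.≡-Reasoning
    X = fe (σ x)
    Y = fe (σ y)
    Z = fe (σ z)
    Zꜰ = Z [T↦ F ,F↦ F ]
  axiom-sound ax5 σ = refl
  axiom-sound ax6 σ = replace-identity (fe (σ x))
  axiom-sound ax7 σ = refl
  axiom-sound ax8 σ = replace-assoc (fe (σ x)) F T F F
  axiom-sound ax9 σ = ≡.trans (replace-assoc X F F _ Y) (≡.sym (replace-assoc X T T Y _))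
    where X = fe (σ x); Y = fe (σ y)
  axiom-sound ax10 σ = cong₂ (λ p q → fe (σ x) [T↦ p ,F↦ q ])
    (replace-assoc (fe (σ y)) F F T T) (≡.sym (replace-assoc (fe (σ y)) T T F F))
  axiom-sound axU1 σ = refl
  axiom-sound axU2 σ = refl

  soundness : {P Q : SP A} → EqFFELU⊢ P ≈ Q → fe P ≡ fe Q
  soundness (axiom ax σ) = axiom-sound ax σ
  soundness refl = refl
  soundness (sym d) = ≡.sym (soundness d)
  soundness (trans d e) = ≡.trans (soundness d) (soundness e)
  soundness (cong¬ d) = cong (λ X → X [T↦ F ,F↦ T ]) (soundness d)
  soundness (cong∧ d e) = cong₂ (λ X Y → X [T↦ Y ,F↦ Y [T↦ F ,F↦ F ] ]) (soundness d) (soundness e)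
  soundness (cong∨ d e) = cong₂ (λ X Y → X [T↦ Y [T↦ T ,F↦ T ] ,F↦ Y ]) (soundness d) (soundness e)

  infix  4 _≈_
  infixr 3 _∙_

  _≈_ : SP A → SP A → Set
  P ≈ Q = EqFFELU⊢ P ≈ Q

  _∙_ : {P Q R : SP A} → P ≈ Q → Q ≈ R → P ≈ R
  _∙_ = trans

  ≡⇒≈ : {P Q : SP A} → P ≡ Q → P ≈ Q
  ≡⇒≈ refl = refl

  ∧-congʳ : {P P' Q : SP A} → P ≈ P' → P ∧• Q ≈ P' ∧• Q
  ∧-congʳ d = cong∧ d refl

  ∧-congˡ : {P Q Q' : SP A} → Q ≈ Q' → P ∧• Q ≈ P ∧• Q'
  ∧-congˡ d = cong∧ refl d

  ∨-congʳ : {P P' Q : SP A} → P ≈ P' → P ∨• Q ≈ P' ∨• Q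
  ∨-congʳ d = cong∨ d refl

  ∨-congˡ : {P Q Q' : SP A} → Q ≈ Q' → P ∨• Q ≈ P ∨• Q'
  ∨-congˡ d = cong∨ refl d

  instantiate : SP A → SP A → SP A → Var3 → SP A
  instantiate P Q R x = P
  instantiate P Q R y = Q
  instantiate P Q R z = R

  F≈¬T : `F ≈ ¬' `T
  F≈¬T = axiom ax1 (instantiate `T `T `T)

  ∨≈¬∧¬ : (P Q : SP A) → P ∨• Q ≈ ¬' (¬' P ∧• ¬' Q)
  ∨≈¬∧¬ P Q = axiom ax2 (instantiate P Q `T)

  ¬-involutive : (P : SP A) → ¬' ¬' P ≈ P
  ¬-involutive P = axiom ax3 (instantiate P `T `T)

  ∧-assoc : (P Q R : SP A) → (P ∧• Q) ∧• R ≈ P ∧• (Q ∧• R)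
  ∧-assoc P Q R = axiom ax4 (instantiate P Q R)

  ∧-identityˡ : (P : SP A) → `T ∧• P ≈ P
  ∧-identityˡ P = axiom ax5 (instantiate P `T `T)

  ∧-identityʳ : (P : SP A) → P ∧• `T ≈ P
  ∧-identityʳ P = axiom ax6 (instantiate P `T `T)

  ∧F≈F∧ : (P : SP A) → P ∧• `F ≈ `F ∧• P
  ∧F≈F∧ P = axiom ax7 (instantiate P `T `T)

  ¬∧F≈∧F : (P : SP A) → ¬' P ∧• `F ≈ P ∧• `F
  ¬∧F≈∧F P = axiom ax8 (instantiate P `T `T)

  ∧F∨≈∨T∧ : (P Q : SP A) → (P ∧• `F) ∨• Q ≈ (P ∨• `T) ∧• Q
  ∧F∨≈∨T∧ P Q = axiom ax9 (instantiate P Q `T)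

  ∨∧F≈∧∨T : (P Q : SP A) → P ∨• (Q ∧• `F) ≈ P ∧• (Q ∨• `T)
  ∨∧F≈∧∨T P Q = axiom ax10 (instantiate P Q `T)

  ¬U≈U : ¬' `U ≈ `U
  ¬U≈U = axiom axU1 (instantiate `T `T `T)

  U∧≈U : (P : SP A) → `U ∧• P ≈ `U
  U∧≈U P = axiom axU2 (instantiate P `T `T)

  ¬T≈F : ¬' `T ≈ `F
  ¬T≈F = sym F≈¬T

  ¬F≈T : ¬' `F ≈ `T
  ¬F≈T = cong¬ F≈¬T ∙ ¬-involutive `T

  F∧F≈F : `F ∧• `F ≈ `F
  F∧F≈F = ∧-congʳ F≈¬T ∙ ¬∧F≈∧F `T ∙ ∧-identityˡ `F

  F∧U≈U : `F ∧• `U ≈ `U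
  F∧U≈U = sym (∧F≈F∧ `U) ∙ U∧≈U `F

  ¬-distrib-∧ : (P Q : SP A) → ¬' (P ∧• Q) ≈ ¬' P ∨• ¬' Q
  ¬-distrib-∧ P Q = sym (∨≈¬∧¬ (¬' P) (¬' Q) ∙ cong¬ (cong∧ (¬-involutive P) (¬-involutive Q)))

  ¬-distrib-∨ : (P Q : SP A) → ¬' (P ∨• Q) ≈ ¬' P ∧• ¬' Q
  ¬-distrib-∨ P Q = cong¬ (∨≈¬∧¬ P Q) ∙ ¬-involutive _

  ∨-assoc : (P Q R : SP A) → (P ∨• Q) ∨• R ≈ P ∨• (Q ∨• R)
  ∨-assoc P Q R = ∨≈¬∧¬ _ _
    ∙ cong¬ (∧-congʳ (¬-distrib-∨ P Q) ∙ ∧-assoc _ _ _ ∙ ∧-congˡ (sym (¬-distrib-∨ Q R)))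
    ∙ sym (∨≈¬∧¬ _ _)

  ∨-identityˡ : (P : SP A) → `F ∨• P ≈ P
  ∨-identityˡ P = ∨≈¬∧¬ _ _ ∙ cong¬ (∧-congʳ ¬F≈T ∙ ∧-identityˡ _) ∙ ¬-involutive P

  ∨T≈¬∧F : (P : SP A) → P ∨• `T ≈ ¬' (P ∧• `F)
  ∨T≈¬∧F P = ∨≈¬∧¬ _ _ ∙ cong¬ (∧-congˡ ¬T≈F ∙ ¬∧F≈∧F P)

  T∨≈¬¬∧F : (P : SP A) → `T ∨• P ≈ ¬' (¬' P ∧• `F)
  T∨≈¬¬∧F P = ∨≈¬∧¬ _ _ ∙ cong¬ (∧-congʳ ¬T≈F ∙ sym (∧F≈F∧ _))

  ∨U≈∧U : (P : SP A) → P ∨• `U ≈ P ∧• `U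
  ∨U≈∧U P = ∨-congˡ (sym (U∧≈U `F)) ∙ ∨∧F≈∧∨T _ _ ∙ ∧-congˡ (∨T≈¬∧F _ ∙ cong¬ (U∧≈U `F) ∙ ¬U≈U)

  ¬∧U≈∧U : (P : SP A) → ¬' P ∧• `U ≈ P ∧• `U
  ¬∧U≈∧U P = ∧-congˡ (sym F∧U≈U) ∙ sym (∧-assoc _ _ _) ∙ ∧-congʳ (¬∧F≈∧F P)
    ∙ ∧-assoc _ _ _ ∙ ∧-congˡ F∧U≈U

  ¬-∧U : (P : SP A) → ¬' (P ∧• `U) ≈ P ∧• `U
  ¬-∧U P = ¬-distrib-∧ _ _ ∙ ∨-congˡ ¬U≈U ∙ ∨U≈∧U _ ∙ ¬∧U≈∧U P

  -- T-after ds evaluates the atoms ds in turn and then yields T.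
  T-after : List A → SP A
  T-after [] = `T
  T-after (d ∷ ds) = (atom d ∨• `T) ∧• T-after ds

  atoms : SP A → List A
  atoms `T = []
  atoms `F = []
  atoms `U = []
  atoms (atom a) = a ∷ []
  atoms (¬' P) = atoms P
  atoms (P ∧• Q) = atoms P ++ atoms Q
  atoms (P ∨• Q) = atoms P ++ atoms Q

  U-free : SP A → Set
  U-free `T = ⊤
  U-free `F = ⊤
  U-free `U = ⊥
  U-free (atom a) = ⊤
  U-free (¬' P) = U-free P
  U-free (P ∧• Q) = U-free P × U-free Q
  U-free (P ∨• Q) = U-free P × U-free Q

  T-after-++ : (ds es : List A) → T-after ds ∧• T-after es ≈ T-after (ds ++ es)
  T-after-++ [] es = ∧-identityˡ _
  T-after-++ (d ∷ ds) es = ∧-assoc _ _ _ ∙ ∧-congˡ (T-after-++ ds es)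

  ¬-T-after∧F : (ds : List A) → ¬' (T-after ds ∧• `F) ≈ T-after ds
  ¬-T-after∧F [] = cong¬ (∧-identityˡ _) ∙ ¬F≈T
  ¬-T-after∧F (d ∷ ds) = cong¬ (∧-assoc _ _ _) ∙ ¬-distrib-∧ _ _ ∙ ∨-congˡ (¬-T-after∧F ds)
    ∙ ∨-congʳ (cong¬ (∨T≈¬∧F _) ∙ ¬-involutive _) ∙ ∧F∨≈∨T∧ _ _

  ¬-T-after : (ds : List A) → ¬' T-after ds ≈ T-after ds ∧• `F
  ¬-T-after ds = cong¬ (sym (¬-T-after∧F ds)) ∙ ¬-involutive _

  T-after∨T : (ds : List A) → T-after ds ∨• `T ≈ T-after ds
  T-after∨T ds = ∨T≈¬∧F _ ∙ ¬-T-after∧F ds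

  T-after∧≈∧F∨ : (ds : List A) (P : SP A) → T-after ds ∧• P ≈ (T-after ds ∧• `F) ∨• P
  T-after∧≈∧F∨ ds P = ∧-congʳ (sym (T-after∨T ds)) ∙ sym (∧F∨≈∨T∧ _ _)

  T-after∧-∨-assoc : (ds : List A) (P Q : SP A) → T-after ds ∧• (P ∨• Q) ≈ (T-after ds ∧• P) ∨• Q
  T-after∧-∨-assoc ds P Q = T-after∧≈∧F∨ ds _ ∙ sym (∨-assoc _ _ _) ∙ ∨-congʳ (sym (T-after∧≈∧F∨ ds P))

  ¬-T-after∧ : (ds : List A) (P : SP A) → ¬' (T-after ds ∧• P) ≈ T-after ds ∧• ¬' P
  ¬-T-after∧ ds P = ¬-distrib-∧ _ _ ∙ ∨-congʳ (¬-T-after ds) ∙ sym (T-after∧≈∧F∨ ds _)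

  ¬-∧T-after : (P : SP A) (ds : List A) → ¬' (P ∧• T-after ds) ≈ ¬' P ∧• T-after ds
  ¬-∧T-after P ds = ¬-distrib-∧ _ _ ∙ ∨-congˡ (¬-T-after ds) ∙ ∨∧F≈∧∨T _ _ ∙ ∧-congˡ (T-after∨T ds)

  ∧F-absorbs : (P : SP A) (es : List A) → P ∧• `F ≈ T-after (atoms P) ∧• `F →
               P ∧• (T-after es ∧• `F) ≈ T-after (atoms P ++ es) ∧• `F
  ∧F-absorbs P es h = ∧-congˡ (∧F≈F∧ _) ∙ sym (∧-assoc _ _ _) ∙ ∧-congʳ h ∙ ∧-assoc _ _ _
    ∙ ∧-congˡ (sym (∧F≈F∧ _)) ∙ sym (∧-assoc _ _ _) ∙ ∧-congʳ (T-after-++ _ _)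

  ∧F≈T-after-atoms∧F : (P : SP A) → U-free P → P ∧• `F ≈ T-after (atoms P) ∧• `F
  ∧F≈T-after-atoms∧F `T _ = refl
  ∧F≈T-after-atoms∧F `F _ = F∧F≈F ∙ sym (∧-identityˡ _)
  ∧F≈T-after-atoms∧F (atom a) _ = sym (∧-congʳ (∧-identityʳ _ ∙ ∨T≈¬∧F _) ∙ ¬∧F≈∧F _
    ∙ ∧-assoc _ _ _ ∙ ∧-congˡ F∧F≈F)
  ∧F≈T-after-atoms∧F (¬' P) u = ¬∧F≈∧F P ∙ ∧F≈T-after-atoms∧F P u
  ∧F≈T-after-atoms∧F (P ∧• Q) (u , v) = ∧-assoc _ _ _ ∙ ∧-congˡ (∧F≈T-after-atoms∧F Q v)
    ∙ ∧F-absorbs P (atoms Q) (∧F≈T-after-atoms∧F P u)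
  ∧F≈T-after-atoms∧F (P ∨• Q) (u , v) = ∧-congʳ (∨≈¬∧¬ _ _) ∙ ¬∧F≈∧F _ ∙ ∧-assoc _ _ _
    ∙ ∧-congˡ (¬∧F≈∧F _ ∙ ∧F≈T-after-atoms∧F Q v)
    ∙ ∧F-absorbs (¬' P) (atoms Q) (¬∧F≈∧F _ ∙ ∧F≈T-after-atoms∧F P u)

  ∧U≈T-after-atoms∧U : (P : SP A) → U-free P → P ∧• `U ≈ T-after (atoms P) ∧• `U
  ∧U≈T-after-atoms∧U P u = ∧-congˡ (sym F∧U≈U) ∙ sym (∧-assoc _ _ _)
    ∙ ∧-congʳ (∧F≈T-after-atoms∧F P u) ∙ ∧-assoc _ _ _ ∙ ∧-congˡ F∧U≈U

  -- Normal forms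

  -- A core is the left-nested term ((T-after ds ∧ ℓ) op₁ K₁) op₂ K₂ … with ℓ a literal and the Kᵢ
  -- cores; in a well-formed core no Kᵢ has opᵢ as its own top operator.  A normal form is
  -- T-after ds, T-after ds ∧ F, T-after ds ∧ U, or a core followed by T-after e.
  data Core : Set where
    core : List A → Bool → A → List (Op × Core) → Core

  Spine : Set
  Spine = List (Op × Core)

  data NF : Set where
    constant  : Bool → List A → NF
    undefined : List A → NF
    essential : Core → List A → NF

  literal : Bool → A → SP A
  literal true a = atom a
  literal false a = ¬' atom a

  applyOp : Op → SP A → SP A → SP A
  applyOp AND P Q = P ∧• Q
  applyOp OR P Q = P ∨• Q

  mutual
    coreTerm : Core → SP A
    coreTerm (core ds p a S) = spineTerm (T-after ds ∧• literal p a) S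

    spineTerm : SP A → Spine → SP A
    spineTerm H [] = H
    spineTerm H ((o , K) ∷ S) = spineTerm (applyOp o H (coreTerm K)) S

  nfTerm : NF → SP A
  nfTerm (constant true ds) = T-after ds
  nfTerm (constant false ds) = T-after ds ∧• `F
  nfTerm (undefined ds) = T-after ds ∧• `U
  nfTerm (essential K e) = coreTerm K ∧• T-after e

  topOp : Spine → Maybe Op
  topOp [] = nothing
  topOp ((o , _) ∷ []) = just o
  topOp (_ ∷ s ∷ S) = topOp (s ∷ S)

  spineOf : Core → Spine
  spineOf (core _ _ _ S) = S

  mutual
    WfCore : Core → Set
    WfCore (core _ _ _ S) = WfSpine S

    WfSpine : Spine → Set
    WfSpine [] = ⊤
    WfSpine ((o , K) ∷ S) = (topOp (spineOf K) ≢ just o) × WfCore K × WfSpine S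

  WfNF : NF → Set
  WfNF (essential K e) = WfCore K
  WfNF _ = ⊤

  extend : Core → Spine → Core
  extend (core ds p a S) S' = core ds p a (S ++ S')

  prefixCore : List A → Core → Core
  prefixCore ds (core es p a S) = core (ds ++ es) p a S

  prefix : List A → NF → NF
  prefix ds (constant b es) = constant b (ds ++ es)
  prefix ds (undefined es) = undefined (ds ++ es)
  prefix ds (essential K e) = essential (prefixCore ds K) e

  suffix : List A → NF → NF
  suffix e (constant b ds) = constant b (ds ++ e)
  suffix e (undefined ds) = undefined ds
  suffix e (essential K e') = essential K (e' ++ e)

  coreAtoms : Core → List A
  coreAtoms K = atoms (coreTerm K)

  mutual
    negCore : Core → Core
    negCore (core ds p a S) = core ds (not p) a (negSpine S)

    negSpine : Spine → Spine
    negSpine [] = []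
    negSpine ((o , K) ∷ S) = (dual o , negCore K) ∷ negSpine S

  negNF : NF → NF
  negNF (constant b ds) = constant (not b) ds
  negNF (undefined ds) = undefined ds
  negNF (essential K e) = essential (negCore K) e

  record AndSplit (S : Spine) : Set where
    constructor mkAndSplit
    field
      front tail  : Spine
      split       : S ≡ front ++ tail
      tail-AND    : All (λ s → proj₁ s ≡ AND) tail
      front-¬AND  : topOp front ≢ just AND

  andSplit : (S : Spine) → AndSplit S
  andSplit [] = mkAndSplit [] [] refl [] (λ ())
  andSplit (s ∷ S) = cons s (andSplit S)
    where
    cons : (s : Op × Core) {S : Spine} → AndSplit S → AndSplit (s ∷ S)
    cons (AND , K) (mkAndSplit [] t eq ands _) =
      mkAndSplit [] ((AND , K) ∷ t) (cong ((AND , K) ∷_) eq) (refl ∷ ands) (λ ())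
    cons (OR , K) (mkAndSplit [] t eq ands _) =
      mkAndSplit ((OR , K) ∷ []) t (cong ((OR , K) ∷_) eq) ands (λ ())
    cons s (mkAndSplit (s' ∷ f) t eq ands top) = mkAndSplit (s ∷ s' ∷ f) t (cong (s ∷_) eq) ands top

  -- The trailing conjunctions of the right core move up to the outer spine.
  andCore : Core → Core → Core
  andCore (core ds p a S) (core es q b S') =
    core ds p a (S ++ (AND , core es q b (AndSplit.front sp)) ∷ AndSplit.tail sp)
    where sp = andSplit S'

  andNF : NF → NF → NF
  andNF (undefined ds) N = undefined ds
  andNF (constant false ds) (undefined es) = undefined (ds ++ es)
  andNF (constant false ds) N = constant false (ds ++ atoms (nfTerm N))
  andNF (constant true ds) N = prefix ds N
  andNF (essential K e) (constant true ds) = essential K (e ++ ds)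
  andNF (essential K e) (constant false ds) = constant false (atoms (nfTerm (essential K e)) ++ ds)
  andNF (essential K e) (undefined ds) = undefined (atoms (nfTerm (essential K e)) ++ ds)
  andNF (essential K e) (essential K' e') = essential (andCore K (prefixCore e K')) e'

  nf : SP A → NF
  nf `T = constant true []
  nf `F = constant false []
  nf `U = undefined []
  nf (atom a) = essential (core [] true a []) []
  nf (¬' P) = negNF (nf P)
  nf (P ∧• Q) = andNF (nf P) (nf Q)
  nf (P ∨• Q) = negNF (andNF (negNF (nf P)) (negNF (nf Q)))

  spineTerm-cong : {H H' : SP A} (S : Spine) → H ≈ H' → spineTerm H S ≈ spineTerm H' S
  spineTerm-cong [] d = d
  spineTerm-cong ((AND , K) ∷ S) d = spineTerm-cong S (∧-congʳ d)
  spineTerm-cong ((OR , K) ∷ S) d = spineTerm-cong S (∨-congʳ d)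

  spineTerm-++ : (H : SP A) (S S' : Spine) → spineTerm H (S ++ S') ≡ spineTerm (spineTerm H S) S'
  spineTerm-++ H [] S' = refl
  spineTerm-++ H ((o , K) ∷ S) S' = spineTerm-++ (applyOp o H (coreTerm K)) S S'

  spineTerm-T-after∧ : (ds : List A) (H : SP A) (S : Spine) →
                       spineTerm (T-after ds ∧• H) S ≈ T-after ds ∧• spineTerm H S
  spineTerm-T-after∧ ds H [] = refl
  spineTerm-T-after∧ ds H ((AND , K) ∷ S) = spineTerm-cong S (∧-assoc _ _ _) ∙ spineTerm-T-after∧ ds _ S
  spineTerm-T-after∧ ds H ((OR , K) ∷ S) =
    spineTerm-cong S (sym (T-after∧-∨-assoc ds _ _)) ∙ spineTerm-T-after∧ ds _ S

  ¬-literal : (p : Bool) (a : A) → ¬' literal p a ≈ literal (not p) a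
  ¬-literal true a = refl
  ¬-literal false a = ¬-involutive _

  mutual
    negCore-correct : (K : Core) → ¬' coreTerm K ≈ coreTerm (negCore K)
    negCore-correct (core ds p a S) =
      negSpine-correct _ S ∙ spineTerm-cong (negSpine S) (¬-T-after∧ ds _ ∙ ∧-congˡ (¬-literal p a))

    negSpine-correct : (H : SP A) (S : Spine) → ¬' spineTerm H S ≈ spineTerm (¬' H) (negSpine S)
    negSpine-correct H [] = refl
    negSpine-correct H ((AND , K) ∷ S) =
      negSpine-correct _ S ∙ spineTerm-cong (negSpine S) (¬-distrib-∧ _ _ ∙ ∨-congˡ (negCore-correct K))
    negSpine-correct H ((OR , K) ∷ S) =
      negSpine-correct _ S ∙ spineTerm-cong (negSpine S) (¬-distrib-∨ _ _ ∙ ∧-congˡ (negCore-correct K))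

  negNF-correct : (N : NF) → ¬' nfTerm N ≈ nfTerm (negNF N)
  negNF-correct (constant true ds) = ¬-T-after ds
  negNF-correct (constant false ds) = ¬-T-after∧F ds
  negNF-correct (undefined ds) = ¬-∧U _
  negNF-correct (essential K e) = ¬-∧T-after _ e ∙ ∧-congʳ (negCore-correct K)

  atoms-T-after : (ds : List A) → atoms (T-after ds) ≡ ds
  atoms-T-after [] = refl
  atoms-T-after (d ∷ ds) = cong (d ∷_) (atoms-T-after ds)

  T-after-U-free : (ds : List A) → U-free (T-after ds)
  T-after-U-free [] = tt
  T-after-U-free (d ∷ ds) = (tt , tt) , T-after-U-free ds

  literal-U-free : (p : Bool) (a : A) → U-free (literal p a)
  literal-U-free true a = tt
  literal-U-free false a = tt

  mutual
    coreTerm-U-free : (K : Core) → U-free (coreTerm K)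
    coreTerm-U-free (core ds p a S) = spineTerm-U-free _ S (T-after-U-free ds , literal-U-free p a)

    spineTerm-U-free : (H : SP A) (S : Spine) → U-free H → U-free (spineTerm H S)
    spineTerm-U-free H [] u = u
    spineTerm-U-free H ((AND , K) ∷ S) u = spineTerm-U-free _ S (u , coreTerm-U-free K)
    spineTerm-U-free H ((OR , K) ∷ S) u = spineTerm-U-free _ S (u , coreTerm-U-free K)

  essential-U-free : (K : Core) (e : List A) → U-free (nfTerm (essential K e))
  essential-U-free K e = coreTerm-U-free K , T-after-U-free e

  prefixCore-correct : (ds : List A) (K : Core) → T-after ds ∧• coreTerm K ≈ coreTerm (prefixCore ds K)
  prefixCore-correct ds (core es p a S) =
    sym (spineTerm-T-after∧ ds _ S) ∙ spineTerm-cong S (sym (∧-assoc _ _ _) ∙ ∧-congʳ (T-after-++ ds es))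

  prefix-correct : (ds : List A) (N : NF) → T-after ds ∧• nfTerm N ≈ nfTerm (prefix ds N)
  prefix-correct ds (constant true es) = T-after-++ ds es
  prefix-correct ds (constant false es) = sym (∧-assoc _ _ _) ∙ ∧-congʳ (T-after-++ ds es)
  prefix-correct ds (undefined es) = sym (∧-assoc _ _ _) ∙ ∧-congʳ (T-after-++ ds es)
  prefix-correct ds (essential K e) = sym (∧-assoc _ _ _) ∙ ∧-congʳ (prefixCore-correct ds K)

  ∧-spineTerm-AND : (P H : SP A) (S : Spine) → All (λ s → proj₁ s ≡ AND) S →
                    P ∧• spineTerm H S ≈ spineTerm (P ∧• H) S
  ∧-spineTerm-AND P H [] [] = refl
  ∧-spineTerm-AND P H ((AND , K) ∷ S) (refl ∷ ands) =
    ∧-spineTerm-AND P _ S ands ∙ spineTerm-cong S (sym (∧-assoc _ _ _))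

  andCore-correct : (K K' : Core) → coreTerm K ∧• coreTerm K' ≈ coreTerm (andCore K K')
  andCore-correct (core ds p a S) (core es q b S') =
    ∧-congˡ (≡⇒≈ (≡.trans (cong (spineTerm H') split) (spineTerm-++ H' front tail)))
    ∙ ∧-spineTerm-AND _ _ tail tail-AND
    ∙ ≡⇒≈ (≡.sym (spineTerm-++ (T-after ds ∧• literal p a) S ((AND , core es q b front) ∷ tail)))
    where
    H' = T-after es ∧• literal q b
    open AndSplit (andSplit S')

  F∧-absorbs : (ds : List A) (P : SP A) → U-free P →
               (T-after ds ∧• `F) ∧• P ≈ T-after (ds ++ atoms P) ∧• `F
  F∧-absorbs ds P u = ∧-assoc _ _ _ ∙ ∧-congˡ (sym (∧F≈F∧ P) ∙ ∧F≈T-after-atoms∧F P u)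
    ∙ sym (∧-assoc _ _ _) ∙ ∧-congʳ (T-after-++ _ _)

  andNF-correct : (M N : NF) → nfTerm M ∧• nfTerm N ≈ nfTerm (andNF M N)
  andNF-correct (undefined ds) N = ∧-assoc _ _ _ ∙ ∧-congˡ (U∧≈U _)
  andNF-correct (constant false ds) (undefined es) = ∧-assoc _ _ _
    ∙ ∧-congˡ (sym (∧-assoc _ _ _) ∙ ∧-congʳ (sym (∧F≈F∧ _)) ∙ ∧-assoc _ _ _ ∙ ∧-congˡ F∧U≈U)
    ∙ sym (∧-assoc _ _ _) ∙ ∧-congʳ (T-after-++ ds es)
  andNF-correct (constant false ds) (constant true es) = F∧-absorbs ds _ (T-after-U-free es)
  andNF-correct (constant false ds) (constant false es) = F∧-absorbs ds _ (T-after-U-free es , tt)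
  andNF-correct (constant false ds) (essential K e) = F∧-absorbs ds _ (essential-U-free K e)
  andNF-correct (constant true ds) N = prefix-correct ds N
  andNF-correct (essential K e) (constant true ds) = ∧-assoc _ _ _ ∙ ∧-congˡ (T-after-++ e ds)
  andNF-correct (essential K e) (constant false ds) =
    ∧F-absorbs _ ds (∧F≈T-after-atoms∧F _ (essential-U-free K e))
  andNF-correct (essential K e) (undefined ds) =
    sym (∧-assoc _ _ _) ∙ ∧U≈T-after-atoms∧U _ (essential-U-free K e , T-after-U-free ds)
    ∙ ≡⇒≈ (cong (λ es → T-after (atoms (nfTerm (essential K e)) ++ es) ∧• `U) (atoms-T-after ds))
  andNF-correct (essential K e) (essential K' e') = sym (∧-assoc _ _ _)
    ∙ ∧-congʳ (∧-assoc _ _ _ ∙ ∧-congˡ (prefixCore-correct e K') ∙ andCore-correct K (prefixCore e K'))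

  negNF-nf-correct : (P : SP A) → P ≈ nfTerm (nf P) → ¬' P ≈ nfTerm (negNF (nf P))
  negNF-nf-correct P d = cong¬ d ∙ negNF-correct (nf P)

  nf-correct : (P : SP A) → P ≈ nfTerm (nf P)
  nf-correct `T = refl
  nf-correct `F = sym (∧-identityˡ _)
  nf-correct `U = sym (∧-identityˡ _)
  nf-correct (atom a) = sym (∧-identityʳ _ ∙ ∧-identityˡ _)
  nf-correct (¬' P) = negNF-nf-correct P (nf-correct P)
  nf-correct (P ∧• Q) = cong∧ (nf-correct P) (nf-correct Q) ∙ andNF-correct (nf P) (nf Q)
  nf-correct (P ∨• Q) = ∨≈¬∧¬ _ _
    ∙ cong¬ (cong∧ (negNF-nf-correct P (nf-correct P)) (negNF-nf-correct Q (nf-correct Q))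
             ∙ andNF-correct (negNF (nf P)) (negNF (nf Q)))
    ∙ negNF-correct (andNF (negNF (nf P)) (negNF (nf Q)))

  WfSpine-++ : (S S' : Spine) → WfSpine S → WfSpine S' → WfSpine (S ++ S')
  WfSpine-++ [] S' _ w' = w'
  WfSpine-++ ((o , K) ∷ S) S' (t , wK , w) w' = t , wK , WfSpine-++ S S' w w'

  WfSpine-++⁻ : (S S' : Spine) → WfSpine (S ++ S') → WfSpine S × WfSpine S'
  WfSpine-++⁻ [] S' w = tt , w
  WfSpine-++⁻ ((o , K) ∷ S) S' (t , wK , w) with WfSpine-++⁻ S S' w
  ... | wS , wS' = (t , wK , wS) , wS'

  topOp-negSpine : (S : Spine) (o : Op) → topOp (negSpine S) ≡ just (dual o) → topOp S ≡ just o
  topOp-negSpine ((AND , K) ∷ []) AND refl = refl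
  topOp-negSpine ((OR , K) ∷ []) OR refl = refl
  topOp-negSpine (s ∷ s' ∷ S) o eq = topOp-negSpine (s' ∷ S) o eq

  mutual
    negCore-wf : (K : Core) → WfCore K → WfCore (negCore K)
    negCore-wf (core ds p a S) w = negSpine-wf S w

    negSpine-wf : (S : Spine) → WfSpine S → WfSpine (negSpine S)
    negSpine-wf [] w = tt
    negSpine-wf ((o , core es q b S') ∷ S) (t , wK , w) =
      (λ eq → t (topOp-negSpine S' o eq)) , negCore-wf (core es q b S') wK , negSpine-wf S w

  negNF-wf : (N : NF) → WfNF N → WfNF (negNF N)
  negNF-wf (constant b ds) w = tt
  negNF-wf (undefined ds) w = tt
  negNF-wf (essential K e) w = negCore-wf K w

  prefixCore-wf : (ds : List A) (K : Core) → WfCore K → WfCore (prefixCore ds K)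
  prefixCore-wf ds (core es p a S) w = w

  prefix-wf : (ds : List A) (N : NF) → WfNF N → WfNF (prefix ds N)
  prefix-wf ds (constant b es) w = tt
  prefix-wf ds (undefined es) w = tt
  prefix-wf ds (essential K e) w = prefixCore-wf ds K w

  andCore-wf : (K K' : Core) → WfCore K → WfCore K' → WfCore (andCore K K')
  andCore-wf (core ds p a S) (core es q b S') w w' =
    WfSpine-++ S _ w (front-¬AND , WfSpine-++⁻ front tail (≡.subst WfSpine split w'))
    where open AndSplit (andSplit S')

  andNF-wf : (M N : NF) → WfNF M → WfNF N → WfNF (andNF M N)
  andNF-wf (undefined ds) N _ _ = tt
  andNF-wf (constant false ds) (undefined es) _ _ = tt
  andNF-wf (constant false ds) (constant b es) _ _ = tt
  andNF-wf (constant false ds) (essential K e) _ _ = tt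
  andNF-wf (constant true ds) N _ w = prefix-wf ds N w
  andNF-wf (essential K e) (constant true ds) w _ = w
  andNF-wf (essential K e) (constant false ds) _ _ = tt
  andNF-wf (essential K e) (undefined ds) _ _ = tt
  andNF-wf (essential K e) (essential K' e') w w' =
    andCore-wf K (prefixCore e K') w (prefixCore-wf e K' w')

  nf-wf : (P : SP A) → WfNF (nf P)
  nf-wf `T = tt
  nf-wf `F = tt
  nf-wf `U = tt
  nf-wf (atom a) = tt
  nf-wf (¬' P) = negNF-wf (nf P) (nf-wf P)
  nf-wf (P ∧• Q) = andNF-wf (nf P) (nf Q) (nf-wf P) (nf-wf Q)
  nf-wf (P ∨• Q) = negNF-wf (andNF (negNF (nf P)) (negNF (nf Q)))
    (andNF-wf (negNF (nf P)) (negNF (nf Q)) (negNF-wf (nf P) (nf-wf P)) (negNF-wf (nf Q) (nf-wf Q)))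

  boolTerm : Bool → SP A
  boolTerm true = `T
  boolTerm false = `F

  -- The normal form of spineTerm (boolTerm v) S: what remains of a core once its literal
  -- has been evaluated to v.
  restrict : Bool → Spine → NF
  restrict v [] = constant v []
  restrict true ((AND , K) ∷ S) = essential (extend K S) []
  restrict false ((AND , K) ∷ S) = prefix (coreAtoms K) (restrict false S)
  restrict true ((OR , K) ∷ S) = prefix (coreAtoms K) (restrict true S)
  restrict false ((OR , K) ∷ S) = essential (extend K S) []

  suffix-correct : (e : List A) (N : NF) → nfTerm (suffix e N) ≈ nfTerm N ∧• T-after e
  suffix-correct e (constant true ds) = sym (T-after-++ ds e)
  suffix-correct e (constant false ds) = sym (∧-assoc _ _ _ ∙ ∧-congˡ (sym (∧F≈F∧ _))
    ∙ sym (∧-assoc _ _ _) ∙ ∧-congʳ (T-after-++ ds e))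
  suffix-correct e (undefined ds) = sym (∧-assoc _ _ _ ∙ ∧-congˡ (U∧≈U _))
  suffix-correct e (essential K e') = sym (∧-assoc _ _ _ ∙ ∧-congˡ (T-after-++ e' e))

  extend-correct : (K : Core) (S : Spine) → nfTerm (essential (extend K S) []) ≈ spineTerm (coreTerm K) S
  extend-correct (core es q b S') S = ∧-identityʳ _ ∙ ≡⇒≈ (spineTerm-++ _ S' S)

  T∨-absorbs : (P : SP A) → U-free P → `T ∨• P ≈ T-after (atoms P) ∧• `T
  T∨-absorbs P u = T∨≈¬¬∧F P ∙ cong¬ (¬∧F≈∧F P ∙ ∧F≈T-after-atoms∧F P u) ∙ ¬-T-after∧F _
    ∙ sym (∧-identityʳ _)

  restrict-correct : (v : Bool) (S : Spine) → nfTerm (restrict v S) ≈ spineTerm (boolTerm v) S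
  restrict-correct true [] = refl
  restrict-correct false [] = ∧-identityˡ _
  restrict-correct true ((AND , K) ∷ S) = extend-correct K S ∙ spineTerm-cong S (sym (∧-identityˡ _))
  restrict-correct false ((OR , K) ∷ S) = extend-correct K S ∙ spineTerm-cong S (sym (∨-identityˡ _))
  restrict-correct false ((AND , K) ∷ S) =
    sym (prefix-correct (coreAtoms K) (restrict false S)) ∙ ∧-congˡ (restrict-correct false S)
    ∙ sym (spineTerm-T-after∧ (coreAtoms K) `F S)
    ∙ spineTerm-cong S (sym (∧F≈T-after-atoms∧F (coreTerm K) (coreTerm-U-free K)) ∙ ∧F≈F∧ _)
  restrict-correct true ((OR , K) ∷ S) =
    sym (prefix-correct (coreAtoms K) (restrict true S)) ∙ ∧-congˡ (restrict-correct true S)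
    ∙ sym (spineTerm-T-after∧ (coreAtoms K) `T S)
    ∙ spineTerm-cong S (sym (T∨-absorbs (coreTerm K) (coreTerm-U-free K)))

  literal-value : Bool → Bool → Bool
  literal-value true c = c
  literal-value false c = not c

  branch : Bool → Bool → Spine → List A → NF
  branch p c S e = suffix e (restrict (literal-value p c) S)

  applyOpᵗ : Op → Tree A → Tree A → Tree A
  applyOpᵗ AND X Y = X [T↦ Y ,F↦ Y [T↦ F ,F↦ F ] ]
  applyOpᵗ OR X Y = X [T↦ Y [T↦ T ,F↦ T ] ,F↦ Y ]

  spineTree : Tree A → Spine → Tree A
  spineTree X [] = X
  spineTree X ((o , K) ∷ S) = spineTree (applyOpᵗ o X (fe (coreTerm K))) S

  fe-spineTerm : (H : SP A) (S : Spine) → fe (spineTerm H S) ≡ spineTree (fe H) S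
  fe-spineTerm H [] = refl
  fe-spineTerm H ((AND , K) ∷ S) = fe-spineTerm _ S
  fe-spineTerm H ((OR , K) ∷ S) = fe-spineTerm _ S

  spineTree-node : (X Z : Tree A) (a : A) (S : Spine) →
                   spineTree (X ⊴ a ⊵ Z) S ≡ (spineTree X S ⊴ a ⊵ spineTree Z S)
  spineTree-node X Z a [] = refl
  spineTree-node X Z a ((AND , K) ∷ S) = spineTree-node _ _ a S
  spineTree-node X Z a ((OR , K) ∷ S) = spineTree-node _ _ a S

  fe-T∧literal : (p : Bool) (a : A) →
    fe (`T ∧• literal p a) ≡
      (fe (boolTerm (literal-value p true)) ⊴ a ⊵ fe (boolTerm (literal-value p false)))
  fe-T∧literal true a = refl
  fe-T∧literal false a = refl

  fe-suffix-restrict : (v : Bool) (S : Spine) (e : List A) →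
    fe (nfTerm (suffix e (restrict v S))) ≡ applyOpᵗ AND (spineTree (fe (boolTerm v)) S) (fe (T-after e))
  fe-suffix-restrict v S e =
    ≡.trans (soundness (suffix-correct e (restrict v S) ∙ ∧-congʳ (restrict-correct v S)))
    (cong (λ X → applyOpᵗ AND X (fe (T-after e))) (fe-spineTerm (boolTerm v) S))

  fe-essential-root : (p : Bool) (a : A) (S : Spine) (e : List A) →
    fe (nfTerm (essential (core [] p a S) e)) ≡
      (fe (nfTerm (branch p true S e)) ⊴ a ⊵ fe (nfTerm (branch p false S e)))
  fe-essential-root p a S e = begin
    applyOpᵗ AND (fe (spineTerm (`T ∧• literal p a) S)) E
      ≡⟨ cong (λ X → applyOpᵗ AND X E) (≡.trans (fe-spineTerm _ S)
           (≡.trans (cong (λ X → spineTree X S) (fe-T∧literal p a)) (spineTree-node _ _ a S))) ⟩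
    applyOpᵗ AND (spineTree (fe (boolTerm (literal-value p true))) S ⊴ a ⊵
                  spineTree (fe (boolTerm (literal-value p false))) S) E
      ≡⟨ cong₂ (_⊴ a ⊵_) (≡.sym (fe-suffix-restrict (literal-value p true) S e))
                          (≡.sym (fe-suffix-restrict (literal-value p false) S e)) ⟩
    (fe (nfTerm (branch p true S e)) ⊴ a ⊵ fe (nfTerm (branch p false S e))) ∎
    where
    open ≡.≡-Reasoning
    E = fe (T-after e)

  addDummy : A → NF → NF
  addDummy d (constant b ds) = constant b (d ∷ ds)
  addDummy d (undefined ds) = undefined (d ∷ ds)
  addDummy d (essential (core ds p a S) e) = essential (core (d ∷ ds) p a S) e

  fe-addDummy : (d : A) (N : NF) → fe (nfTerm (addDummy d N)) ≡ (fe (nfTerm N) ⊴ d ⊵ fe (nfTerm N))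
  fe-addDummy d (constant true ds) = refl
  fe-addDummy d (constant false ds) = refl
  fe-addDummy d (undefined ds) = refl
  fe-addDummy d (essential (core ds p a S) e) =
    cong (λ X → applyOpᵗ AND X (fe (T-after e))) (begin
      fe (spineTerm (((atom d ∨• `T) ∧• T-after ds) ∧• literal p a) S)
        ≡⟨ fe-spineTerm _ S ⟩
      spineTree (fe H ⊴ d ⊵ fe H) S
        ≡⟨ spineTree-node _ _ d S ⟩
      (spineTree (fe H) S ⊴ d ⊵ spineTree (fe H) S)
        ≡⟨ cong (λ X → X ⊴ d ⊵ X) (≡.sym (fe-spineTerm H S)) ⟩
      (fe (spineTerm H S) ⊴ d ⊵ fe (spineTerm H S)) ∎)
    where
    open ≡.≡-Reasoning
    H = T-after ds ∧• literal p a

  data View : NF → Set where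
    constant-view  : (b : Bool) → View (constant b [])
    undefined-view : View (undefined [])
    dummy-view     : (d : A) (N : NF) → View (addDummy d N)
    literal-view   : (p : Bool) (a : A) (S : Spine) (e : List A) → View (essential (core [] p a S) e)

  view : (N : NF) → View N
  view (constant b []) = constant-view b
  view (constant b (d ∷ ds)) = dummy-view d (constant b ds)
  view (undefined []) = undefined-view
  view (undefined (d ∷ ds)) = dummy-view d (undefined ds)
  view (essential (core [] p a S) e) = literal-view p a S e
  view (essential (core (d ∷ ds) p a S) e) = dummy-view d (essential (core ds p a S) e)

  infix 4 _≼_

  data _≼_ : Tree A → Tree A → Set where
    T≼T  : T ≼ T
    F≼F  : F ≼ F
    U≼U  : U ≼ U
    F≼T  : F ≼ T
    node : ∀ {X X' Z Z' a} → X ≼ X' → Z ≼ Z' → (X ⊴ a ⊵ Z) ≼ (X' ⊴ a ⊵ Z')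

  ≼-refl : (X : Tree A) → X ≼ X
  ≼-refl T = T≼T
  ≼-refl F = F≼F
  ≼-refl U = U≼U
  ≼-refl (X ⊴ a ⊵ Z) = node (≼-refl X) (≼-refl Z)

  ≼-antisym : {X Y : Tree A} → X ≼ Y → Y ≼ X → X ≡ Y
  ≼-antisym T≼T _ = refl
  ≼-antisym F≼F _ = refl
  ≼-antisym U≼U _ = refl
  ≼-antisym (node p q) (node p' q') = cong₂ (_⊴ _ ⊵_) (≼-antisym p p') (≼-antisym q q')

  replace-F-≼ : (Y : Tree A) → Y [T↦ F ,F↦ F ] ≼ Y
  replace-F-≼ T = F≼T
  replace-F-≼ F = F≼F
  replace-F-≼ U = U≼U
  replace-F-≼ (X ⊴ a ⊵ Z) = node (replace-F-≼ X) (replace-F-≼ Z)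

  ≼-replace-T : (Y : Tree A) → Y ≼ Y [T↦ T ,F↦ T ]
  ≼-replace-T T = T≼T
  ≼-replace-T F = F≼T
  ≼-replace-T U = U≼U
  ≼-replace-T (X ⊴ a ⊵ Z) = node (≼-replace-T X) (≼-replace-T Z)

  replace-mono : {X X' : Tree A} (Y Z : Tree A) → X ≼ X' → Z ≼ Y → X [T↦ Y ,F↦ Z ] ≼ X' [T↦ Y ,F↦ Z ]
  replace-mono Y Z T≼T q = ≼-refl Y
  replace-mono Y Z F≼F q = ≼-refl Z
  replace-mono Y Z U≼U q = U≼U
  replace-mono Y Z F≼T q = q
  replace-mono Y Z (node p p') q = node (replace-mono Y Z p q) (replace-mono Y Z p' q)

  applyOpᵗ-monoˡ : (o : Op) {X X' : Tree A} (Y : Tree A) → X ≼ X' → applyOpᵗ o X Y ≼ applyOpᵗ o X' Y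
  applyOpᵗ-monoˡ AND Y p = replace-mono _ _ p (replace-F-≼ Y)
  applyOpᵗ-monoˡ OR Y p = replace-mono _ _ p (≼-replace-T Y)

  spineTree-mono : {X X' : Tree A} (S : Spine) → X ≼ X' → spineTree X S ≼ spineTree X' S
  spineTree-mono [] p = p
  spineTree-mono ((o , K) ∷ S) p = spineTree-mono S (applyOpᵗ-monoˡ o _ p)

  restrict-mono : (S : Spine) (e : List A) →
                  fe (nfTerm (suffix e (restrict false S))) ≼ fe (nfTerm (suffix e (restrict true S)))
  restrict-mono S e rewrite fe-suffix-restrict false S e | fe-suffix-restrict true S e =
    applyOpᵗ-monoˡ AND _ (spineTree-mono S F≼T)

  mutual
    ess-core : Core → ℕ
    ess-core (core _ _ _ S) = suc (ess-spine S)

    ess-spine : Spine → ℕ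
    ess-spine [] = 0
    ess-spine ((o , K) ∷ S) = ess-core K + ess-spine S

  -- The number of essential (non-dummy) atoms.
  ess : NF → ℕ
  ess (essential K e) = ess-core K
  ess _ = 0

  ess-spine-++ : (S S' : Spine) → ess-spine (S ++ S') ≡ ess-spine S + ess-spine S'
  ess-spine-++ [] S' = refl
  ess-spine-++ ((o , K) ∷ S) S' =
    ≡.trans (cong (ess-core K +_) (ess-spine-++ S S'))
            (≡.sym (+-assoc (ess-core K) (ess-spine S) (ess-spine S')))

  ess-prefix : (ds : List A) (N : NF) → ess (prefix ds N) ≡ ess N
  ess-prefix ds (constant b es) = refl
  ess-prefix ds (undefined es) = refl
  ess-prefix ds (essential (core es p a S) e) = refl

  ess-suffix : (e : List A) (N : NF) → ess (suffix e N) ≡ ess N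
  ess-suffix e (constant b es) = refl
  ess-suffix e (undefined es) = refl
  ess-suffix e (essential K e') = refl

  ess-extend : (K : Core) (S : Spine) → ess-core (extend K S) ≡ ess-core K + ess-spine S
  ess-extend (core es q b S') S = cong suc (ess-spine-++ S' S)

  ess-spine<ess-extend : (K : Core) (V S : Spine) → ess-spine S < ess-core (extend K (V ++ S))
  ess-spine<ess-extend (core es q b S') V S rewrite ess-spine-++ S' (V ++ S) | ess-spine-++ V S =
    s≤s (≤-trans (m≤n+m (ess-spine S) (ess-spine V)) (m≤n+m _ (ess-spine S')))

  ess-restrict-≤ : (v : Bool) (S : Spine) → ess (restrict v S) ≤ ess-spine S
  ess-restrict-≤ true [] = z≤n
  ess-restrict-≤ false [] = z≤n
  ess-restrict-≤ true ((AND , K) ∷ S) = ≤-reflexive (ess-extend K S)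
  ess-restrict-≤ false ((OR , K) ∷ S) = ≤-reflexive (ess-extend K S)
  ess-restrict-≤ false ((AND , K) ∷ S) rewrite ess-prefix (coreAtoms K) (restrict false S) =
    ≤-trans (ess-restrict-≤ false S) (m≤n+m _ (ess-core K))
  ess-restrict-≤ true ((OR , K) ∷ S) rewrite ess-prefix (coreAtoms K) (restrict true S) =
    ≤-trans (ess-restrict-≤ true S) (m≤n+m _ (ess-core K))

  ess-suffix-prefix : (e ds : List A) (N : NF) → ess (suffix e (prefix ds N)) ≡ ess N
  ess-suffix-prefix e ds N = ≡.trans (ess-suffix e (prefix ds N)) (ess-prefix ds N)

  extend-ess-gap : (K : Core) (S : Spine) {n : ℕ} → n ≤ ess-spine S → ess-core (extend K S) ≢ n
  extend-ess-gap K S n≤ eq =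
    <-irrefl refl (<-≤-trans (ess-spine<ess-extend K [] S) (≤-trans (≤-reflexive eq) n≤))

  restrict-true≢false : (S : Spine) (e : List A) →
                        suffix e (restrict true S) ≢ suffix e (restrict false S)
  restrict-true≢false [] e ()
  restrict-true≢false ((AND , K) ∷ S) e eq = extend-ess-gap K S (ess-restrict-≤ false S)
    (≡.trans (cong ess eq) (ess-suffix-prefix e (coreAtoms K) (restrict false S)))
  restrict-true≢false ((OR , K) ∷ S) e eq = extend-ess-gap K S (ess-restrict-≤ true S)
    (≡.trans (cong ess (≡.sym eq)) (ess-suffix-prefix e (coreAtoms K) (restrict true S)))

  branch-true≢false : (p : Bool) (S : Spine) (e : List A) → branch p true S e ≢ branch p false S e
  branch-true≢false true S e = restrict-true≢false S e
  branch-true≢false false S e eq = restrict-true≢false S e (≡.sym eq)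

  topOp-++ : (S : Spine) (s : Op × Core) (V : Spine) → topOp (S ++ s ∷ V) ≡ topOp (s ∷ V)
  topOp-++ [] s V = refl
  topOp-++ (s' ∷ []) s V = refl
  topOp-++ (s' ∷ s'' ∷ S) s V = topOp-++ (s'' ∷ S) s V

  -- The value that makes o ignore its right argument.
  absorbing : Op → Bool
  absorbing AND = false
  absorbing OR = true

  ess-spine<ess-restrict-absorbing : (o : Op) (s : Op × Core) (V S : Spine) → topOp (s ∷ V) ≢ just o →
                                     ess-spine S < ess (restrict (absorbing o) ((s ∷ V) ++ S))
  ess-spine<ess-restrict-absorbing AND (AND , K) [] S ne = ⊥-elim (ne refl)
  ess-spine<ess-restrict-absorbing AND (AND , K) (s ∷ V) S ne
    rewrite ess-prefix (coreAtoms K) (restrict false ((s ∷ V) ++ S)) =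
      ess-spine<ess-restrict-absorbing AND s V S ne
  ess-spine<ess-restrict-absorbing AND (OR , K) V S ne = ess-spine<ess-extend K V S
  ess-spine<ess-restrict-absorbing OR (OR , K) [] S ne = ⊥-elim (ne refl)
  ess-spine<ess-restrict-absorbing OR (OR , K) (s ∷ V) S ne
    rewrite ess-prefix (coreAtoms K) (restrict true ((s ∷ V) ++ S)) =
      ess-spine<ess-restrict-absorbing OR s V S ne
  ess-spine<ess-restrict-absorbing OR (AND , K) V S ne = ess-spine<ess-extend K V S

  spine-overlap-absurd : (o : Op) (SK SK' S S' : Spine) (s : Op × Core) (V : Spine) →
    topOp SK ≢ just o → SK ≡ SK' ++ s ∷ V → S' ≡ (s ∷ V) ++ S →
    ess (restrict (absorbing o) S) ≢ ess (restrict (absorbing o) S')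
  spine-overlap-absurd o SK SK' S S' s V top refl refl eq =
    <-irrefl refl (<-≤-trans (ess-spine<ess-restrict-absorbing o s V S ne)
                             (≤-trans (≤-reflexive (≡.sym eq)) (ess-restrict-≤ (absorbing o) S)))
    where
    ne : topOp (s ∷ V) ≢ just o
    ne eq' = top (≡.trans (topOp-++ SK' s V) eq')

  core-injective : ∀ {ds ds' p p' a a' S S'} → core ds p a S ≡ core ds' p' a' S' →
                   ds ≡ ds' × p ≡ p' × a ≡ a' × S ≡ S'
  core-injective refl = refl , refl , refl , refl

  extend-injective : (o : Op) (K K' : Core) (S S' : Spine) →
    topOp (spineOf K) ≢ just o → topOp (spineOf K') ≢ just o → extend K S ≡ extend K' S' →
    ess (restrict (absorbing o) S) ≡ ess (restrict (absorbing o) S') → K ≡ K' × S ≡ S'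
  extend-injective o (core ds p a SK) (core ds' p' a' SK') S S' top top' eq count
    with core-injective eq
  ... | refl , refl , refl , eqS with ++-≡-++ SK S SK' S' eqS
  ...   | inj₁ (refl , refl) = refl , refl
  ...   | inj₂ (inj₁ (s , V , p₁ , p₂)) = ⊥-elim (spine-overlap-absurd o SK SK' S S' s V top p₁ p₂ count)
  ...   | inj₂ (inj₂ (s , V , p₁ , p₂)) =
    ⊥-elim (spine-overlap-absurd o SK' SK S' S s V top' p₁ p₂ (≡.sym count))

  extend-wf : (K : Core) (S : Spine) → WfCore K → WfSpine S → WfCore (extend K S)
  extend-wf (core es q b S') S = WfSpine-++ S' S

  suffix-wf : (e : List A) (N : NF) → WfNF N → WfNF (suffix e N)
  suffix-wf e (constant b es) w = tt
  suffix-wf e (undefined es) w = tt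
  suffix-wf e (essential K e') w = w

  restrict-wf : (v : Bool) (S : Spine) → WfSpine S → WfNF (restrict v S)
  restrict-wf true [] w = tt
  restrict-wf false [] w = tt
  restrict-wf true ((AND , K) ∷ S) (_ , wK , w) = extend-wf K S wK w
  restrict-wf false ((OR , K) ∷ S) (_ , wK , w) = extend-wf K S wK w
  restrict-wf false ((AND , K) ∷ S) (_ , _ , w) =
    prefix-wf (coreAtoms K) (restrict false S) (restrict-wf false S w)
  restrict-wf true ((OR , K) ∷ S) (_ , _ , w) =
    prefix-wf (coreAtoms K) (restrict true S) (restrict-wf true S w)

  branch-wf : (p c : Bool) (S : Spine) (e : List A) → WfSpine S → WfNF (branch p c S e)
  branch-wf p c S e w =
    suffix-wf e (restrict (literal-value p c) S) (restrict-wf (literal-value p c) S w)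

  addDummy-wf⁻ : (d : A) (N : NF) → WfNF (addDummy d N) → WfNF N
  addDummy-wf⁻ d (constant b ds) w = tt
  addDummy-wf⁻ d (undefined ds) w = tt
  addDummy-wf⁻ d (essential (core ds p a S) e) w = w

  essential-injective : ∀ {K K' e e'} → essential K e ≡ essential K' e' → K ≡ K' × e ≡ e'
  essential-injective refl = refl , refl

  ess-cong-suffix-prefix : (e e' ds ds' : List A) (N N' : NF) →
    suffix e (prefix ds N) ≡ suffix e' (prefix ds' N') → ess N ≡ ess N'
  ess-cong-suffix-prefix e e' ds ds' N N' eq =
    ≡.trans (≡.sym (ess-suffix-prefix e ds N)) (≡.trans (cong ess eq) (ess-suffix-prefix e' ds' N'))

  spine-unique-same-op : (o : Op) (K K' : Core) (S S' : Spine) (e e' : List A) →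
    topOp (spineOf K) ≢ just o → topOp (spineOf K') ≢ just o →
    ((v : Bool) → suffix e (restrict v ((o , K) ∷ S)) ≡ suffix e' (restrict v ((o , K') ∷ S'))) →
    (o , K) ∷ S ≡ (o , K') ∷ S' × e ≡ e'
  spine-unique-same-op AND K K' S S' e e' top top' agree with essential-injective (agree true)
  ... | eqK , refl with extend-injective AND K K' S S' top top' eqK
                          (ess-cong-suffix-prefix e e _ _ _ _ (agree false))
  ...   | refl , refl = refl , refl
  spine-unique-same-op OR K K' S S' e e' top top' agree with essential-injective (agree false)
  ... | eqK , refl with extend-injective OR K K' S S' top top' eqK
                          (ess-cong-suffix-prefix e e _ _ _ _ (agree true))
  ...   | refl , refl = refl , refl

  spine-unique-mixed-op-absurd : (K K' : Core) (S S' : Spine) (e e' : List A) →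
    ((v : Bool) → suffix e (restrict v ((AND , K) ∷ S)) ≡ suffix e' (restrict v ((OR , K') ∷ S'))) → ⊥
  spine-unique-mixed-op-absurd K K' S S' e e' agree = <-irrefl refl (begin-strict
    ess-spine S                    <⟨ ess-spine<ess-extend K [] S ⟩
    ess-core (extend K S)          ≡⟨ ≡.trans (cong ess (agree true))
                                              (ess-suffix-prefix e' _ (restrict true S')) ⟩
    ess (restrict true S')         ≤⟨ ess-restrict-≤ true S' ⟩
    ess-spine S'                   <⟨ ess-spine<ess-extend K' [] S' ⟩
    ess-core (extend K' S')        ≡⟨ ≡.trans (cong ess (≡.sym (agree false)))
                                              (ess-suffix-prefix e _ (restrict false S)) ⟩
    ess (restrict false S)         ≤⟨ ess-restrict-≤ false S ⟩
    ess-spine S                    ∎)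
    where open ≤-Reasoning

  spine-unique : (S S' : Spine) (e e' : List A) → WfSpine S → WfSpine S' →
    ((v : Bool) → suffix e (restrict v S) ≡ suffix e' (restrict v S')) → S ≡ S' × e ≡ e'
  spine-unique [] [] e e' _ _ agree with agree true
  ... | refl = refl , refl
  spine-unique [] ((AND , K') ∷ S') e e' _ _ agree with agree true
  ... | ()
  spine-unique [] ((OR , K') ∷ S') e e' _ _ agree with agree false
  ... | ()
  spine-unique ((AND , K) ∷ S) [] e e' _ _ agree with agree true
  ... | ()
  spine-unique ((OR , K) ∷ S) [] e e' _ _ agree with agree false
  ... | ()
  spine-unique ((AND , K) ∷ S) ((AND , K') ∷ S') e e' (top , _) (top' , _) agree =
    spine-unique-same-op AND K K' S S' e e' top top' agree
  spine-unique ((OR , K) ∷ S) ((OR , K') ∷ S') e e' (top , _) (top' , _) agree =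
    spine-unique-same-op OR K K' S S' e e' top top' agree
  spine-unique ((AND , K) ∷ S) ((OR , K') ∷ S') e e' _ _ agree =
    ⊥-elim (spine-unique-mixed-op-absurd K K' S S' e e' agree)
  spine-unique ((OR , K) ∷ S) ((AND , K') ∷ S') e e' _ _ agree =
    ⊥-elim (spine-unique-mixed-op-absurd K' K S' S e' e (λ v → ≡.sym (agree v)))

  -- A tree determines its well-formed normal form

  IsNode : Tree A → Set
  IsNode (_ ⊴ _ ⊵ _) = ⊤
  IsNode _ = ⊥

  leafNF : Tree A → NF
  leafNF T = constant true []
  leafNF F = constant false []
  leafNF _ = undefined []

  view-leaf : {N : NF} → View N → ¬ IsNode (fe (nfTerm N)) → N ≡ leafNF (fe (nfTerm N))
  view-leaf (constant-view true) _ = refl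
  view-leaf (constant-view false) _ = refl
  view-leaf undefined-view _ = refl
  view-leaf (dummy-view d N) leaf = ⊥-elim (leaf (≡.subst IsNode (≡.sym (fe-addDummy d N)) tt))
  view-leaf (literal-view p a S e) leaf =
    ⊥-elim (leaf (≡.subst IsNode (≡.sym (fe-essential-root p a S e)) tt))

  AtMostOneNF : Tree A → Set
  AtMostOneNF X = (N N' : NF) → WfNF N → WfNF N' → fe (nfTerm N) ≡ X → fe (nfTerm N') ≡ X → N ≡ N'

  leaf-unique : (X : Tree A) → ¬ IsNode X → AtMostOneNF X
  leaf-unique X leaf N N' _ _ refl h' = begin
    N                        ≡⟨ view-leaf (view N) leaf ⟩
    leafNF (fe (nfTerm N))   ≡⟨ cong leafNF (≡.sym h') ⟩
    leafNF (fe (nfTerm N'))  ≡⟨ ≡.sym (view-leaf (view N') (≡.subst (¬_ ∘ IsNode) (≡.sym h') leaf)) ⟩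
    N'                       ∎
    where open ≡.≡-Reasoning

  ⊴⊵-injective : ∀ {L L' R R' : Tree A} {a a'} → (L ⊴ a ⊵ R) ≡ (L' ⊴ a' ⊵ R') → L ≡ L' × a ≡ a' × R ≡ R'
  ⊴⊵-injective refl = refl , refl , refl

  literal-branches-distinct : {L R : Tree A} → AtMostOneNF L →
    (p : Bool) (S : Spine) (e : List A) → WfSpine S →
    fe (nfTerm (branch p true S e)) ≡ L → fe (nfTerm (branch p false S e)) ≡ R → L ≢ R
  literal-branches-distinct uniqueL p S e w hL hR refl =
    branch-true≢false p S e (uniqueL _ _ (branch-wf p true S e w) (branch-wf p false S e w) hL hR)

  opposite-literals-same-branches : (S S' : Spine) (e e' : List A) {L R : Tree A} →
    fe (nfTerm (suffix e (restrict true S))) ≡ L → fe (nfTerm (suffix e (restrict false S))) ≡ R →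
    fe (nfTerm (suffix e' (restrict false S'))) ≡ L → fe (nfTerm (suffix e' (restrict true S'))) ≡ R →
    L ≡ R
  opposite-literals-same-branches S S' e e' refl refl hL' hR' =
    ≼-antisym (≡.subst₂ _≼_ hL' hR' (restrict-mono S' e')) (restrict-mono S e)

  restrictions-agree : (p : Bool) (S S' : Spine) (e e' : List A) →
    branch p true S e ≡ branch p true S' e' → branch p false S e ≡ branch p false S' e' →
    (v : Bool) → suffix e (restrict v S) ≡ suffix e' (restrict v S')
  restrictions-agree true S S' e e' eqT eqF true = eqT
  restrictions-agree true S S' e e' eqT eqF false = eqF
  restrictions-agree false S S' e e' eqT eqF true = eqF
  restrictions-agree false S S' e e' eqT eqF false = eqT

  same-polarity-unique : {L R : Tree A} → AtMostOneNF L → AtMostOneNF R →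
    (p : Bool) (a : A) (S S' : Spine) (e e' : List A) → WfSpine S → WfSpine S' →
    fe (nfTerm (branch p true S e)) ≡ L → fe (nfTerm (branch p false S e)) ≡ R →
    fe (nfTerm (branch p true S' e')) ≡ L → fe (nfTerm (branch p false S' e')) ≡ R →
    essential (core [] p a S) e ≡ essential (core [] p a S') e'
  same-polarity-unique uniqueL uniqueR p a S S' e e' w w' hL hR hL' hR'
    with spine-unique S S' e e' w w' (restrictions-agree p S S' e e'
           (uniqueL _ _ (branch-wf p true S e w) (branch-wf p true S' e' w') hL hL')
           (uniqueR _ _ (branch-wf p false S e w) (branch-wf p false S' e' w') hR hR'))
  ... | refl , refl = refl

  literal-unique : {L R : Tree A} → AtMostOneNF L → AtMostOneNF R →
    (p p' : Bool) (a : A) (S S' : Spine) (e e' : List A) → WfSpine S → WfSpine S' →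
    fe (nfTerm (branch p true S e)) ≡ L → fe (nfTerm (branch p false S e)) ≡ R →
    fe (nfTerm (branch p' true S' e')) ≡ L → fe (nfTerm (branch p' false S' e')) ≡ R →
    essential (core [] p a S) e ≡ essential (core [] p' a S') e'
  literal-unique uniqueL uniqueR true true = same-polarity-unique uniqueL uniqueR true
  literal-unique uniqueL uniqueR false false = same-polarity-unique uniqueL uniqueR false
  literal-unique uniqueL uniqueR true false a S S' e e' w w' hL hR hL' hR' = ⊥-elim
    (literal-branches-distinct uniqueL true S e w hL hR
      (opposite-literals-same-branches S S' e e' hL hR hL' hR'))
  literal-unique uniqueL uniqueR false true a S S' e e' w w' hL hR hL' hR' = ⊥-elim
    (literal-branches-distinct uniqueL false S e w hL hR
      (opposite-literals-same-branches S' S e' e hL' hR' hL hR))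

  node-unique : {L R : Tree A} {a : A} → AtMostOneNF L → AtMostOneNF R →
    {N N' : NF} → View N → View N' → WfNF N → WfNF N' →
    fe (nfTerm N) ≡ (L ⊴ a ⊵ R) → fe (nfTerm N') ≡ (L ⊴ a ⊵ R) → N ≡ N'
  node-unique _ _ (constant-view true) _ _ _ () _
  node-unique _ _ (constant-view false) _ _ _ () _
  node-unique _ _ undefined-view _ _ _ () _
  node-unique _ _ (dummy-view _ _) (constant-view true) _ _ _ ()
  node-unique _ _ (dummy-view _ _) (constant-view false) _ _ _ ()
  node-unique _ _ (dummy-view _ _) undefined-view _ _ _ ()
  node-unique _ _ (literal-view _ _ _ _) (constant-view true) _ _ _ ()
  node-unique _ _ (literal-view _ _ _ _) (constant-view false) _ _ _ ()
  node-unique _ _ (literal-view _ _ _ _) undefined-view _ _ _ ()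
  node-unique uniqueL _ (dummy-view d M) (dummy-view d' M') w w' h h'
    with ⊴⊵-injective (≡.trans (≡.sym (fe-addDummy d M)) h)
       | ⊴⊵-injective (≡.trans (≡.sym (fe-addDummy d' M')) h')
  ... | hL , refl , _ | hL' , refl , _ =
    cong (addDummy d) (uniqueL M M' (addDummy-wf⁻ d M w) (addDummy-wf⁻ d M' w') hL hL')
  node-unique uniqueL _ (dummy-view d M) (literal-view p b S e) _ w' h h'
    with ⊴⊵-injective (≡.trans (≡.sym (fe-addDummy d M)) h)
       | ⊴⊵-injective (≡.trans (≡.sym (fe-essential-root p b S e)) h')
  ... | hL , _ , hR | hL' , _ , hR' =
    ⊥-elim (literal-branches-distinct uniqueL p S e w' hL' hR' (≡.trans (≡.sym hL) hR))
  node-unique uniqueL _ (literal-view p b S e) (dummy-view d M) w _ h h'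
    with ⊴⊵-injective (≡.trans (≡.sym (fe-essential-root p b S e)) h)
       | ⊴⊵-injective (≡.trans (≡.sym (fe-addDummy d M)) h')
  ... | hL , _ , hR | hL' , _ , hR' =
    ⊥-elim (literal-branches-distinct uniqueL p S e w hL hR (≡.trans (≡.sym hL') hR'))
  node-unique uniqueL uniqueR (literal-view p b S e) (literal-view p' b' S' e') w w' h h'
    with ⊴⊵-injective (≡.trans (≡.sym (fe-essential-root p b S e)) h)
       | ⊴⊵-injective (≡.trans (≡.sym (fe-essential-root p' b' S' e')) h')
  ... | hL , refl , hR | hL' , refl , hR' =
    literal-unique uniqueL uniqueR p p' b S S' e e' w w' hL hR hL' hR'

  nf-unique : (X : Tree A) → AtMostOneNF X
  nf-unique T = leaf-unique T (λ ())
  nf-unique F = leaf-unique F (λ ())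
  nf-unique U = leaf-unique U (λ ())
  nf-unique (L ⊴ a ⊵ R) N N' =
    node-unique (nf-unique L) (nf-unique R) (view N) (view N')

  completeness : (P Q : SP A) → fe P ≡ fe Q → P ≈ Q
  completeness P Q eq = nf-correct P ∙ ≡⇒≈ (cong nfTerm nf-P≡nf-Q) ∙ sym (nf-correct Q)
    where
    nf-P≡nf-Q : nf P ≡ nf Q
    nf-P≡nf-Q = nf-unique (fe Q) (nf P) (nf Q) (nf-wf P) (nf-wf Q)
      (≡.trans (≡.sym (soundness (nf-correct P))) eq) (≡.sym (soundness (nf-correct Q)))

theorem3p13 : (A : Set) → Countable A → (P Q : SP A) →
    (EqFFELU⊢ P ≈ Q) ⇔ (fe P ≡ fe Q)
theorem3p13 A _ P Q = mk⇔ soundness (completeness P Q)
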